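{- Let $(S,\preceq,\otimes_1,\otimes_2,D_1,D_2,\{e\},\{e\})$ be a partial interchange monoid whose two unit sets both equal $\{e\}$. Define ternary relations on $S$ by $R^x_{yz}\Leftrightarrow(D_1\,y\,z\wedge x=y\otimes_1 z)$ and $T^x_{yz}\Leftrightarrow(D_2\,y\,z\wedge x\preceq y\otimes_2 z)$. Then $R$ and $T$ are each relationally associative and, for all $t,u,v,w,x\in S$: $R^x_{uv}\Rightarrow T^x_{uv}$; $R^x_{uv}\Rightarrow T^x_{vu}$; $(\exists y.\ R^x_{uy}\wedge T^y_{vw})\Rightarrow(\exists y.\ R^y_{uv}\wedge T^x_{yw})$; $(\exists y.\ T^y_{uv}\wedge R^x_{yw})\Rightarrow(\exists y.\ T^x_{uy}\wedge R^y_{vw})$; $(\exists y.\ R^x_{uy}\wedge T^y_{vw})\Rightarrow(\exists y.\ T^x_{vy}\wedge R^y_{uw})$; $(\exists y.\ T^y_{uv}\wedge R^x_{yw})\Rightarrow(\exists y.\ R^y_{uw}\wedge T^x_{yv})$; $(\exists y,z.\ T^y_{tu}\wedge R^x_{yz}\wedge T^z_{vw})\Rightarrow(\exists y,z.\ R^y_{tv}\wedge T^x_{yz}\wedge R^z_{uw})$.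
   Context: Relational associativity of $R$: for all $x,u,v,w$, $(\exists y.\ R^y_{uv}\wedge R^x_{yw})\Leftrightarrow(\exists y.\ R^x_{uy}\wedge R^y_{vw})$. A partial monoid $(S,\otimes,D,E)$: $D\subseteq S\times S$, $\otimes:D\to S$, with $(D\,x\,y\wedge D\,(x\otimes y)\,z)\Leftrightarrow(D\,y\,z\wedge D\,x\,(y\otimes z))$ and then $x\otimes(y\otimes z)=(x\otimes y)\otimes z$; $E\subseteq S$ such that each $x$ has $e\in E$ with $D\,e\,x$, $e\otimes x=x$, and $e'\in E$ with $D\,x\,e'$, $x\otimes e'=x$, and $D\,e_1\,e_2\Rightarrow e_1=e_2$ for $e_1,e_2\in E$. Preordered by preorder $\preceq$: $x\preceq y\wedge D\,z\,x\Rightarrow D\,z\,y\wedge z\otimes x\preceq z\otimes y$ and $x\preceq y\wedge D\,x\,z\Rightarrow D\,y\,z\wedge x\otimes z\preceq y\otimes z$. A partial interchange monoid $(S,\preceq,\otimes_1,\otimes_2,D_1,D_2,E_1,E_2)$: $(S,\preceq,\otimes_i,D_i,E_i)$ are preordered partial monoids ($i=1,2$), $E_2\subseteq E_1$, and for all $w,x,y,z$: if $D_2\,w\,x$, $D_1\,(w\otimes_2 x)\,(y\otimes_2 z)$ and $D_2\,y\,z$, then $D_1\,w\,y$, $D_2\,(w\otimes_1 y)\,(x\otimes_1 z)$, $D_1\,x\,z$ and $(w\otimes_2x)\otimes_1(y\otimes_2z)\preceq(w\otimes_1y)\otimes_2(x\otimes_1z)$. -}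

module Defs where

open import Level using (Level; _⊔_)
open import Data.Product using (Σ; ∃; _×_; _,_)
open import Relation.Binary.PropositionalEquality using (_≡_)
open import Function.Bundles using (_⇔_)

private variable a ℓ : Level

-- Ternary relation: Rel3 S with  R x y z  meaning  R^x_{yz}.
Rel3 : (S : Set a) (ℓ : Level) → Set (a ⊔ Level.suc ℓ)
Rel3 {a} S ℓ = S → S → S → Set ℓ

RelAssoc : {S : Set a} → Rel3 S ℓ → Set (a ⊔ ℓ)
RelAssoc {S = S} R = ∀ x u v w →
  (∃ λ (y : S) → R y u v × R x y w) ⇔ (∃ λ (y : S) → R x u y × R y v w)

record IsPartialMonoid {S : Set a} (D : S → S → Set ℓ)
       (op : (x y : S) → .(D x y) → S) (E : S → Set ℓ) : Set (a ⊔ ℓ) where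
  field
    assoc-dom-→ : ∀ x y z → (Σ (D x y) λ p → D (op x y p) z) →
                              (Σ (D y z) λ r → D x (op y z r))
    assoc-dom-← : ∀ x y z → (Σ (D y z) λ r → D x (op y z r)) →
                              (Σ (D x y) λ p → D (op x y p) z)
    assoc : ∀ x y z (p : D x y) (q : D (op x y p) z)
                    (r : D y z) (s : D x (op y z r)) →
            op x (op y z r) s ≡ op (op x y p) z q
    unitˡ : ∀ x → Σ S λ e → E e × (Σ (D e x) λ p → op e x p ≡ x)
    unitʳ : ∀ x → Σ S λ e' → E e' × (Σ (D x e') λ p → op x e' p ≡ x)
    units-D : ∀ e₁ e₂ → E e₁ → E e₂ → D e₁ e₂ → e₁ ≡ e₂

record IsPreorderRel {S : Set a} (_≼_ : S → S → Set ℓ) : Set (a ⊔ ℓ) where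
  field
    refl≼  : ∀ x → x ≼ x
    trans≼ : ∀ {x y z} → x ≼ y → y ≼ z → x ≼ z

record IsPreorderedPartialMonoid {S : Set a} (_≼_ : S → S → Set ℓ)
       (D : S → S → Set ℓ) (op : (x y : S) → .(D x y) → S)
       (E : S → Set ℓ) : Set (a ⊔ ℓ) where
  field
    isPartialMonoid : IsPartialMonoid D op E
    isPreorder      : IsPreorderRel _≼_
    mono-right : ∀ x y z → x ≼ y → (p : D z x) →
                 Σ (D z y) λ q → op z x p ≼ op z y q
    mono-left  : ∀ x y z → x ≼ y → (p : D x z) →
                 Σ (D y z) λ q → op x z p ≼ op y z q

record IsPartialInterchangeMonoid {S : Set a} (_≼_ : S → S → Set ℓ)
       (D₁ D₂ : S → S → Set ℓ)
       (op₁ : (x y : S) → .(D₁ x y) → S) (op₂ : (x y : S) → .(D₂ x y) → S)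
       (E₁ E₂ : S → Set ℓ) : Set (a ⊔ ℓ) where
  field
    isPPM₁ : IsPreorderedPartialMonoid _≼_ D₁ op₁ E₁
    isPPM₂ : IsPreorderedPartialMonoid _≼_ D₂ op₂ E₂
    E₂⊆E₁  : ∀ x → E₂ x → E₁ x
    interchange : ∀ w x y z (p : D₂ w x) (r : D₂ y z)
                  (q : D₁ (op₂ w x p) (op₂ y z r)) →
      Σ (D₁ w y) λ s → Σ (D₁ x z) λ t →
      Σ (D₂ (op₁ w y s) (op₁ x z t)) λ u →
        op₁ (op₂ w x p) (op₂ y z r) q ≼ op₂ (op₁ w y s) (op₁ x z t) u

module _ {S : Set a} (_≼_ : S → S → Set ℓ) (D₁ D₂ : S → S → Set ℓ)
         (op₁ : (x y : S) → .(D₁ x y) → S) (op₂ : (x y : S) → .(D₂ x y) → S)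
         where
  Rrel : Rel3 S (a ⊔ ℓ)
  Rrel x y z = Σ (D₁ y z) λ p → x ≡ op₁ y z p
  Trel : Rel3 S ℓ
  Trel x y z = Σ (D₂ y z) λ p → x ≼ op₂ y z p

module Submission where

-- Structure of the proof.
--  * R only involves ⊗₁, so its associativity holds for the graph of any
--    partial monoid; T only involves ⊗₂ and ≼, so its associativity holds
--    for the lower-set relation of any preordered partial monoid.
--  * All seven mixed laws are instances of one general fact, valid in every
--    partial interchange monoid (no unit hypothesis):
--      T^y_{tu} ∧ R^x_{yz} ∧ T^z_{vw}  ⇒  ∃ y' z'. R^{y'}_{tv} ∧ T^x_{y'z'} ∧ R^{z'}_{uw},
--    which is monotonicity of ⊗₁ followed by the interchange inequality.
--  * The other six laws follow by feeding this fact unit instances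
--    T^u_{ue}, T^u_{eu} and simplifying R^z_{ew}, R^z_{we} to z = w; this is
--    where the unit sets being exactly {e} is used.

open import Defs
open import Level using (Level; _⊔_)
open import Data.Product using (Σ; ∃; _×_; _,_; proj₂)
open import Relation.Binary.PropositionalEquality
  using (_≡_; refl; sym; trans; subst; subst₂)
open import Function.Bundles using (_⇔_; mk⇔; Equivalence)

private variable a ℓ : Level

Graph : {S : Set a} (D : S → S → Set ℓ) (op : (x y : S) → .(D x y) → S) →
        Rel3 S (a ⊔ ℓ)
Graph D op x y z = Σ (D y z) λ p → x ≡ op y z p

Below : {S : Set a} (_≼_ : S → S → Set ℓ) (D : S → S → Set ℓ)
        (op : (x y : S) → .(D x y) → S) → Rel3 S ℓ
Below _≼_ D op x y z = Σ (D y z) λ p → x ≼ op y z p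

module PartialMonoid {S : Set a} {D : S → S → Set ℓ}
                     {op : (x y : S) → .(D x y) → S} {E : S → Set ℓ}
                     (M : IsPartialMonoid D op E) where
  open IsPartialMonoid M

  graph-assoc : RelAssoc (Graph D op)
  graph-assoc x u v w = mk⇔ reassocʳ reassocˡ
    where
    reassocʳ : (∃ λ y → Graph D op y u v × Graph D op x y w) →
               (∃ λ y → Graph D op x u y × Graph D op y v w)
    reassocʳ (_ , (p , refl) , (q , refl)) with assoc-dom-→ u v w (p , q)
    ... | r , s = op v w r , (s , sym (assoc u v w p q r s)) , (r , refl)

    reassocˡ : (∃ λ y → Graph D op x u y × Graph D op y v w) →
               (∃ λ y → Graph D op y u v × Graph D op x y w)
    reassocˡ (_ , (s , refl) , (r , refl)) with assoc-dom-← u v w (r , s)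
    ... | p , q = op u v p , (p , refl) , (q , assoc u v w p q r s)

  module UniqueUnit (e : S) (E⇒e : ∀ x → E x → x ≡ e) where

    graph-unitˡ : ∀ x → Graph D op x e x
    graph-unitˡ x with unitˡ x
    ... | e' , Ee' , p , e'x≡x with E⇒e e' Ee'
    ... | refl = p , sym e'x≡x

    graph-unitʳ : ∀ x → Graph D op x x e
    graph-unitʳ x with unitʳ x
    ... | e' , Ee' , p , xe'≡x with E⇒e e' Ee'
    ... | refl = p , sym xe'≡x

    -- Definedness proofs are irrelevant, so any product e ⊗ y is y.
    left-unit-law : ∀ {x y} → Graph D op x e y → x ≡ y
    left-unit-law {y = y} (_ , x≡ey) = trans x≡ey (sym (proj₂ (graph-unitˡ y)))

    right-unit-law : ∀ {x y} → Graph D op x y e → x ≡ y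
    right-unit-law {y = y} (_ , x≡ye) = trans x≡ye (sym (proj₂ (graph-unitʳ y)))

module PreorderedPartialMonoid {S : Set a} {_≼_ : S → S → Set ℓ}
         {D : S → S → Set ℓ} {op : (x y : S) → .(D x y) → S} {E : S → Set ℓ}
         (M : IsPreorderedPartialMonoid _≼_ D op E) where
  open IsPreorderedPartialMonoid M
  open IsPartialMonoid isPartialMonoid
  open IsPreorderRel isPreorder

  graph⇒below : ∀ {x y z} → Graph D op x y z → Below _≼_ D op x y z
  graph⇒below (p , refl) = p , refl≼ _

  op-mono : ∀ {y y' z z'} → y ≼ y' → z ≼ z' → (p : D y z) →
            Σ (D y' z') λ q → op y z p ≼ op y' z' q
  op-mono {y} {y'} {z} {z'} y≼y' z≼z' p with mono-left y y' z y≼y' p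
  ... | q , yz≼y'z with mono-right z z' y' z≼z' q
  ... | q' , y'z≼y'z' = q' , trans≼ yz≼y'z y'z≼y'z'

  private
    ≼-respʳ-≡ : ∀ {x y z} → x ≼ y → y ≡ z → x ≼ z
    ≼-respʳ-≡ x≼y refl = x≼y

  -- Associativity of the lower-set relation: an upper bound of a bracketed
  -- product can be pushed through the bracket by monotonicity, after which
  -- the monoid's associativity applies.
  below-assoc : RelAssoc (Below _≼_ D op)
  below-assoc x u v w = mk⇔ reassocʳ reassocˡ
    where
    reassocʳ : (∃ λ y → Below _≼_ D op y u v × Below _≼_ D op x y w) →
               (∃ λ y → Below _≼_ D op x u y × Below _≼_ D op y v w)
    reassocʳ (y , (p , y≼uv) , (q , x≼yw)) with mono-left y (op u v p) w y≼uv q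
    ... | q' , yw≼[uv]w with assoc-dom-→ u v w (p , q')
    ... | r , s = op v w r
                , (s , trans≼ x≼yw (≼-respʳ-≡ yw≼[uv]w (sym (assoc u v w p q' r s))))
                , (r , refl≼ _)

    reassocˡ : (∃ λ y → Below _≼_ D op x u y × Below _≼_ D op y v w) →
               (∃ λ y → Below _≼_ D op y u v × Below _≼_ D op x y w)
    reassocˡ (y , (s , x≼uy) , (r , y≼vw)) with mono-right y (op v w r) u y≼vw s
    ... | s' , uy≼u[vw] with assoc-dom-← u v w (r , s')
    ... | p , q = op u v p
                , (p , refl≼ _)
                , (q , trans≼ x≼uy (≼-respʳ-≡ uy≼u[vw] (assoc u v w p q r s')))

module PartialInterchangeMonoid {S : Set a} {_≼_ : S → S → Set ℓ}
         {D₁ D₂ : S → S → Set ℓ}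
         {op₁ : (x y : S) → .(D₁ x y) → S} {op₂ : (x y : S) → .(D₂ x y) → S}
         {E₁ E₂ : S → Set ℓ}
         (M : IsPartialInterchangeMonoid _≼_ D₁ D₂ op₁ op₂ E₁ E₂) where
  open IsPartialInterchangeMonoid M
  open IsPreorderRel (IsPreorderedPartialMonoid.isPreorder isPPM₁)
  open PreorderedPartialMonoid isPPM₁ using (op-mono)

  -- The relational interchange law: from y ≼ t ⊗₂ u and z ≼ v ⊗₂ w,
  --   y ⊗₁ z ≼ (t ⊗₂ u) ⊗₁ (v ⊗₂ w) ≼ (t ⊗₁ v) ⊗₂ (u ⊗₁ w).
  below-interchange :
    ∀ {t u v w x y z} →
    Below _≼_ D₂ op₂ y t u → Graph D₁ op₁ x y z → Below _≼_ D₂ op₂ z v w →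
    ∃ λ y' → ∃ λ z' → Graph D₁ op₁ y' t v × Below _≼_ D₂ op₂ x y' z' ×
                      Graph D₁ op₁ z' u w
  below-interchange {t} {u} {v} {w} (p , y≼tu) (q , refl) (r , z≼vw)
    with op-mono y≼tu z≼vw q
  ... | q' , yz≼[tu][vw] with interchange t u v w p r q'
  ... | s , s' , d , [tu][vw]≼[tv][uw] =
    op₁ t v s , op₁ u w s' , (s , refl) ,
    (d , trans≼ yz≼[tu][vw] [tu][vw]≼[tv][uw]) , (s' , refl)

-- Each mixed
-- law is the relational interchange law applied to a unit instance of T,
-- followed by cancelling the resulting product with e.
module SharedUnit {S : Set a} {_≼_ : S → S → Set ℓ} {D₁ D₂ : S → S → Set ℓ}
         {op₁ : (x y : S) → .(D₁ x y) → S} {op₂ : (x y : S) → .(D₂ x y) → S}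
         {E₁ E₂ : S → Set ℓ}
         (M : IsPartialInterchangeMonoid _≼_ D₁ D₂ op₁ op₂ E₁ E₂) (e : S)
         (E₁⇒e : ∀ x → E₁ x → x ≡ e) (E₂⇒e : ∀ x → E₂ x → x ≡ e) where
  open IsPartialInterchangeMonoid M
  open PartialMonoid.UniqueUnit
         (IsPreorderedPartialMonoid.isPartialMonoid isPPM₁) e E₁⇒e
    using (left-unit-law; right-unit-law)
  open PartialMonoid.UniqueUnit
         (IsPreorderedPartialMonoid.isPartialMonoid isPPM₂) e E₂⇒e
    using (graph-unitˡ; graph-unitʳ)
  open PreorderedPartialMonoid isPPM₂ using (graph⇒below)
  open PartialInterchangeMonoid M using (below-interchange)

  R : Rel3 S (a ⊔ ℓ)
  R = Graph D₁ op₁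

  T : Rel3 S ℓ
  T = Below _≼_ D₂ op₂

  T-unitˡ : ∀ u → T u e u
  T-unitˡ u = graph⇒below (graph-unitˡ u)

  T-unitʳ : ∀ u → T u u e
  T-unitʳ u = graph⇒below (graph-unitʳ u)

  R⇒T : ∀ x u v → R x u v → T x u v
  R⇒T x u v Rxuv with below-interchange (T-unitʳ u) Rxuv (T-unitˡ v)
  ... | _ , _ , Ry'ue , Txy'z' , Rz'ev =
    subst₂ (T x) (right-unit-law Ry'ue) (left-unit-law Rz'ev) Txy'z'

  R⇒T-swap : ∀ x u v → R x u v → T x v u
  R⇒T-swap x u v Rxuv with below-interchange (T-unitˡ u) Rxuv (T-unitʳ v)
  ... | _ , _ , Ry'ev , Txy'z' , Rz'ue =
    subst₂ (T x) (left-unit-law Ry'ev) (right-unit-law Rz'ue) Txy'z'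

  RT⇒RT : ∀ x u v w → (∃ λ y → R x u y × T y v w) → (∃ λ y → R y u v × T x y w)
  RT⇒RT x u v w (_ , Rxuy , Tyvw) with below-interchange (T-unitʳ u) Rxuy Tyvw
  ... | y' , _ , Ry'uv , Txy'z' , Rz'ew =
    y' , Ry'uv , subst (T x y') (left-unit-law Rz'ew) Txy'z'

  TR⇒TR : ∀ x u v w → (∃ λ y → T y u v × R x y w) → (∃ λ y → T x u y × R y v w)
  TR⇒TR x u v w (_ , Tyuv , Rxyw) with below-interchange Tyuv Rxyw (T-unitˡ w)
  ... | _ , z' , Ry'ue , Txy'z' , Rz'vw =
    z' , subst (λ y → T x y z') (right-unit-law Ry'ue) Txy'z' , Rz'vw

  RT⇒TR : ∀ x u v w → (∃ λ y → R x u y × T y v w) → (∃ λ y → T x v y × R y u w)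
  RT⇒TR x u v w (_ , Rxuy , Tyvw) with below-interchange (T-unitˡ u) Rxuy Tyvw
  ... | _ , z' , Ry'ev , Txy'z' , Rz'uw =
    z' , subst (λ y → T x y z') (left-unit-law Ry'ev) Txy'z' , Rz'uw

  TR⇒RT : ∀ x u v w → (∃ λ y → T y u v × R x y w) → (∃ λ y → R y u w × T x y v)
  TR⇒RT x u v w (_ , Tyuv , Rxyw) with below-interchange Tyuv Rxyw (T-unitʳ w)
  ... | y' , _ , Ry'uw , Txy'z' , Rz've =
    y' , Ry'uw , subst (T x y') (right-unit-law Rz've) Txy'z'

  TRT⇒RTR : ∀ t u v w x → (∃ λ y → ∃ λ z → T y t u × R x y z × T z v w) →
            (∃ λ y → ∃ λ z → R y t v × T x y z × R z u w)
  TRT⇒RTR t u v w x (_ , _ , Tytu , Rxyz , Tzvw) = below-interchange Tytu Rxyz Tzvw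

lemma9p8 : ∀ {a ℓ : Level} {S : Set a} (_≼_ : S → S → Set ℓ)
             (D₁ D₂ : S → S → Set ℓ)
             (op₁ : (x y : S) → .(D₁ x y) → S)
             (op₂ : (x y : S) → .(D₂ x y) → S)
             (E₁ E₂ : S → Set ℓ) (e : S) →
             IsPartialInterchangeMonoid _≼_ D₁ D₂ op₁ op₂ E₁ E₂ →
             (∀ x → E₁ x ⇔ x ≡ e) → (∀ x → E₂ x ⇔ x ≡ e) →
             let R = Rrel _≼_ D₁ D₂ op₁ op₂
                 T = Trel _≼_ D₁ D₂ op₁ op₂
             in RelAssoc R × RelAssoc T ×
                (∀ x u v → R x u v → T x u v) ×
                (∀ x u v → R x u v → T x v u) ×
                (∀ x u v w → (∃ λ y → R x u y × T y v w) →
                             (∃ λ y → R y u v × T x y w)) ×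
                (∀ x u v w → (∃ λ y → T y u v × R x y w) →
                             (∃ λ y → T x u y × R y v w)) ×
                (∀ x u v w → (∃ λ y → R x u y × T y v w) →
                             (∃ λ y → T x v y × R y u w)) ×
                (∀ x u v w → (∃ λ y → T y u v × R x y w) →
                             (∃ λ y → R y u w × T x y v)) ×
                (∀ t u v w x →
                   (∃ λ y → ∃ λ z → T y t u × R x y z × T z v w) →
                   (∃ λ y → ∃ λ z → R y t v × T x y z × R z u w))
lemma9p8 _≼_ D₁ D₂ op₁ op₂ E₁ E₂ e M E₁≡e E₂≡e =
    PartialMonoid.graph-assoc (IsPreorderedPartialMonoid.isPartialMonoid isPPM₁)
  , PreorderedPartialMonoid.below-assoc isPPM₂
  , R⇒T , R⇒T-swap , RT⇒RT , TR⇒TR , RT⇒TR , TR⇒RT , TRT⇒RTR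
  where
  open IsPartialInterchangeMonoid M
  open SharedUnit M e (λ x → Equivalence.to (E₁≡e x)) (λ x → Equivalence.to (E₂≡e x))
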